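{- Let $k\ge 4$ and $t\ge 1$ be integers. For every proper $(k-1)$-coloring $f$ of the supercomplex $S_{k,t}$ with base $\{v_{0,0},v_{0,1}\}$, we have $f(v_{0,1})\ne f(v_{0,0})$.
   Context: The tower $T_{k,t}$ has vertex set $V_0\cup V_1\cup\dots\cup V_t$ with $V_0=\{v_{0,0},v_{0,1}\}$ and $V_i=\{v_{i,0},\dots,v_{i,k-2}\}$ for $1\le i\le t$; for $1\le i\le t$, $V_i$ induces $K_{k-1}$ minus the edge $v_{i,0}v_{i,1}$, the vertex $v_{i-1,0}$ is adjacent to $v_{i,j}$ for all $0\le j\le (k-2)/2$, and $v_{i-1,1}$ is adjacent to $v_{i,j}$ for all $(k-1)/2\le j\le k-2$; there are no other edges. The tower complex $C_{k,t}$ is the union of $k$ copies $T^1,\dots,T^k$ of $T_{k,t}$ sharing the common base $V_0$, otherwise vertex-disjoint, with no edges between $T^i-V_0$ and $T^j-V_0$ for $i\ne j$; write $v^i_{s,j}$ for vertex $v_{s,j}$ of $T^i$. The supercomplex $S_{k,t}$ is obtained from $C_{k,t}$ by adding, for each pair $1\le i<j\le k$, the edge $v^i_{t,0}v^j_{t,1}$ if $j-i\le k/2$, and the edge $v^i_{t,1}v^j_{t,0}$ otherwise; its base is $V_0$. -}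

module Defs where

open import Data.Nat using (ℕ; zero; suc; _+_; _*_; _∸_; _≤_; _<_)
open import Data.Fin using (Fin; toℕ)
open import Relation.Binary.PropositionalEquality using (_≡_; _≢_)
open import Data.Product using (_×_)
open import Relation.Nullary using (¬_)

-- Vertices of the supercomplex S_{k,t}.
--   base₀, base₁            : v_{0,0}, v_{0,1}  (the common base V_0)
--   tow c s a               : v^{c+1}_{s+1, a}   (copy c ∈ {0..k-1} stands for T^{c+1},
--                             level s ∈ {0..t-1} stands for V_{s+1},
--                             position a ∈ {0..k-2})
data Vtx (k t : ℕ) : Set where
  base₀ base₁ : Vtx k t
  tow : Fin k → Fin t → Fin (k ∸ 1) → Vtx k t

-- Edges of S_{k,t} (each undirected edge listed in at least one orientation).
-- "j ≤ (k-2)/2" is encoded as 2j + 2 ≤ k, "(k-1)/2 ≤ j" as k ≤ 2j + 1.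
data Edge (k t : ℕ) : Vtx k t → Vtx k t → Set where
  inner : ∀ (c : Fin k) (s : Fin t) (a b : Fin (k ∸ 1)) →
          toℕ a < toℕ b → ¬ (toℕ a ≡ 0 × toℕ b ≡ 1) →
          Edge k t (tow c s a) (tow c s b)
  base0 : ∀ (c : Fin k) (s : Fin t) (j : Fin (k ∸ 1)) →
          toℕ s ≡ 0 → 2 * toℕ j + 2 ≤ k →
          Edge k t base₀ (tow c s j)
  base1 : ∀ (c : Fin k) (s : Fin t) (j : Fin (k ∸ 1)) →
          toℕ s ≡ 0 → k ≤ 2 * toℕ j + 1 →
          Edge k t base₁ (tow c s j)
  up0 : ∀ (c : Fin k) (s s' : Fin t) (a j : Fin (k ∸ 1)) →
        toℕ s' ≡ suc (toℕ s) → toℕ a ≡ 0 → 2 * toℕ j + 2 ≤ k →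
        Edge k t (tow c s a) (tow c s' j)
  up1 : ∀ (c : Fin k) (s s' : Fin t) (a j : Fin (k ∸ 1)) →
        toℕ s' ≡ suc (toℕ s) → toℕ a ≡ 1 → k ≤ 2 * toℕ j + 1 →
        Edge k t (tow c s a) (tow c s' j)
  topNear : ∀ (c₁ c₂ : Fin k) (s : Fin t) (a b : Fin (k ∸ 1)) →
            toℕ c₁ < toℕ c₂ → 2 * (toℕ c₂ ∸ toℕ c₁) ≤ k →
            suc (toℕ s) ≡ t → toℕ a ≡ 0 → toℕ b ≡ 1 →
            Edge k t (tow c₁ s a) (tow c₂ s b)
  topFar : ∀ (c₁ c₂ : Fin k) (s : Fin t) (a b : Fin (k ∸ 1)) →
           toℕ c₁ < toℕ c₂ → k < 2 * (toℕ c₂ ∸ toℕ c₁) →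
           suc (toℕ s) ≡ t → toℕ a ≡ 1 → toℕ b ≡ 0 →
           Edge k t (tow c₁ s a) (tow c₂ s b)

ProperColoring : (k t : ℕ) → (Vtx k t → Fin (k ∸ 1)) → Set
ProperColoring k t f = ∀ u v → Edge k t u v → f u ≢ f v

module Submission where

open import Defs
open import Data.Nat using (ℕ; _≤_; _∸_; zero; suc; _+_; _*_; _<_; z≤n; s≤s)
import Data.Nat as ℕ
open import Data.Nat.Properties using (≤-<-connex; m<1+n⇒m≤n; +-suc; n<1+n; <-trans)
open import Data.Fin using (Fin; toℕ; fromℕ<) renaming (zero to fz; suc to fs)
import Data.Fin as Fin
open import Data.Fin.Properties using (pigeonhole; toℕ-fromℕ<; toℕ-injective)
open import Data.Product using (_,_; ∃₂; _×_)
open import Data.Sum using (_⊎_; inj₁; inj₂)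
open import Data.Empty using (⊥-elim)
open import Relation.Nullary using (yes; no)
open import Relation.Nullary.Decidable using (_×-dec_)
open import Relation.Binary.PropositionalEquality using (_≢_; _≡_; refl; sym; trans; cong; subst)

-- Suppose f v₀,₀ = f v₀,₁ = x. Every vertex of V₁ sees v₀,₀ or v₀,₁, so V₁ misses the colour x
-- and its k − 1 vertices share k − 2 colours; the only non-adjacent pair is v₁,₀ v₁,₁, which
-- therefore gets one colour. Repeating this up each tower, v_{t,0} and v_{t,1} share a colour
-- in all k copies. Two of the k copies then agree at the top, and whichever top edge joins
-- them is monochromatic.

non-surjective⇒collision : ∀ {n} (g : Fin n → Fin n) (x : Fin n) → (∀ a → g a ≢ x) →
                           ∃₂ λ a b → a Fin.< b × g a ≡ g b
non-surjective⇒collision {n} g x g≢x with pigeonhole (n<1+n n) extend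
  where
  extend : Fin (suc n) → Fin n
  extend fz     = x
  extend (fs a) = g a
... | fz   , fs b , _       , x≡gb = ⊥-elim (g≢x b (sym x≡gb))
... | fs a , fs b , s≤s a<b , ga≡gb = a , b , a<b , ga≡gb

left-or-right-half : ∀ k j → 2 * j + 2 ≤ k ⊎ k ≤ 2 * j + 1
left-or-right-half k j with ≤-<-connex (2 * j + 2) k
... | inj₁ left  = inj₁ left
... | inj₂ right = inj₂ (m<1+n⇒m≤n (subst (k <_) (+-suc (2 * j) 1) right))

module ProperlyColoured (n t : ℕ) (f : Vtx (3 + n) t → Fin (2 + n))
                        (proper : ProperColoring (3 + n) t f) where

  Twins : Fin (3 + n) → Fin t → Set
  Twins c s = f (tow c s fz) ≡ f (tow c s (fs fz))

  DominatedBy : Vtx (3 + n) t → Vtx (3 + n) t → Fin (3 + n) → Fin t → Set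
  DominatedBy u₀ u₁ c s = ∀ j → Edge (3 + n) t u₀ (tow c s j) ⊎ Edge (3 + n) t u₁ (tow c s j)

  first-level-dominatedBy-base : ∀ c s → toℕ s ≡ 0 → DominatedBy base₀ base₁ c s
  first-level-dominatedBy-base c s s≡0 j with left-or-right-half (3 + n) (toℕ j)
  ... | inj₁ left  = inj₁ (base0 c s j s≡0 left)
  ... | inj₂ right = inj₂ (base1 c s j s≡0 right)

  next-level-dominatedBy-twins : ∀ c s s′ → toℕ s′ ≡ suc (toℕ s) →
                                 DominatedBy (tow c s fz) (tow c s (fs fz)) c s′
  next-level-dominatedBy-twins c s s′ s′≡1+s j with left-or-right-half (3 + n) (toℕ j)
  ... | inj₁ left  = inj₁ (up0 c s s′ fz j s′≡1+s refl left)
  ... | inj₂ right = inj₂ (up1 c s s′ (fs fz) j s′≡1+s refl right)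

  dominated-level-avoids : ∀ {u₀ u₁ c s} → f u₀ ≡ f u₁ → DominatedBy u₀ u₁ c s →
                           ∀ j → f (tow c s j) ≢ f u₀
  dominated-level-avoids fu₀≡fu₁ dom j fv≡fu₀ with dom j
  ... | inj₁ u₀v = proper _ _ u₀v (sym fv≡fu₀)
  ... | inj₂ u₁v = proper _ _ u₁v (trans (sym fu₀≡fu₁) (sym fv≡fu₀))

  -- A level is K_{k−1} minus the edge v₀v₁, so a colour clash inside it can only be at (v₀, v₁).
  level-avoiding-colour⇒twins : ∀ {c s} x → (∀ j → f (tow c s j) ≢ x) → Twins c s
  level-avoiding-colour⇒twins {c} {s} x avoids
    with non-surjective⇒collision (λ j → f (tow c s j)) x avoids
  ... | a , b , a<b , fa≡fb with (toℕ a ℕ.≟ 0) ×-dec (toℕ b ℕ.≟ 1)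
  ...   | no  a,b≢0,1       = ⊥-elim (proper _ _ (inner c s a b a<b a,b≢0,1) fa≡fb)
  ...   | yes (a≡0 , b≡1)
    rewrite toℕ-injective {i = a} {j = fz} a≡0 | toℕ-injective {i = b} {j = fs fz} b≡1 = fa≡fb

  twins-at-every-level : f base₀ ≡ f base₁ → ∀ c i (i<t : i < t) → Twins c (fromℕ< i<t)
  twins-at-every-level base-clash c zero i<t =
    level-avoiding-colour⇒twins _
      (dominated-level-avoids base-clash (first-level-dominatedBy-base c _ (toℕ-fromℕ< i<t)))
  twins-at-every-level base-clash c (suc i) 1+i<t =
    level-avoiding-colour⇒twins _
      (dominated-level-avoids (twins-at-every-level base-clash c i i<t)
        (next-level-dominatedBy-twins c _ _
          (trans (toℕ-fromℕ< 1+i<t) (cong suc (sym (toℕ-fromℕ< i<t))))))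
    where
    i<t : i < t
    i<t = <-trans (n<1+n i) 1+i<t

  twin-tops-differ : ∀ {c₁ c₂ s} → c₁ Fin.< c₂ → suc (toℕ s) ≡ t → Twins c₁ s → Twins c₂ s →
                     f (tow c₁ s fz) ≢ f (tow c₂ s fz)
  twin-tops-differ {c₁} {c₂} {s} c₁<c₂ top twins₁ twins₂ clash
    with ≤-<-connex (2 * (toℕ c₂ ∸ toℕ c₁)) (3 + n)
  ... | inj₁ near = proper _ _ (topNear c₁ c₂ s fz (fs fz) c₁<c₂ near top refl refl) (trans clash twins₂)
  ... | inj₂ far  = proper _ _ (topFar c₁ c₂ s (fs fz) fz c₁<c₂ far top refl refl) (trans (sym twins₁) clash)

lemma4p4 : (k t : ℕ) → 4 ≤ k → 1 ≤ t → (f : Vtx k t → Fin (k ∸ 1)) → ProperColoring k t f → f base₁ ≢ f base₀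
lemma4p4 (suc (suc (suc (suc m)))) (suc t) (s≤s (s≤s (s≤s (s≤s z≤n)))) (s≤s z≤n) f proper base-clash
  with pigeonhole (n<1+n _) (λ c → f (tow c top fz))
  where
  top : Fin (suc t)
  top = fromℕ< (n<1+n t)
... | c₁ , c₂ , c₁<c₂ , clash =
  twin-tops-differ c₁<c₂ (cong suc (toℕ-fromℕ< (n<1+n t))) (twins c₁) (twins c₂) clash
  where
  open ProperlyColoured (suc m) (suc t) f proper
  twins : ∀ c → Twins c (fromℕ< (n<1+n t))
  twins c = twins-at-every-level (sym base-clash) c t (n<1+n t)
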